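{- For $S=1.7916$, $P'_S<1.20375$.
   Context: A set system over $[n]$ is a family $\mathcal{F}\subseteq2^{[n]}$; isomorphic set systems differ by a bijective relabeling of $[n]$. A permutation $\pi$ of $[n]$ is supported by $\mathcal{F}$ if all prefix-sets $\{\pi(1),\dots,\pi(i)\}$, $0\le i\le n$, lie in $\mathcal{F}$. $C(\mathcal{F})$ is the number of chains $S_0\subsetneq\dots\subsetneq S_n$ of members of $\mathcal{F}$; $S(\mathcal{F})=|\mathcal{F}|^{1/n}$; $P(\mathcal{F})=(n!/C(\mathcal{F}))^{1/n}$ (or $+\infty$ if $C(\mathcal{F})=0$). $\mathcal{F}_1,\mathcal{F}_2$ on the same ground set are regularly intersecting if there is $\mathcal{G}\subseteq\mathcal{F}_1\cap\mathcal{F}_2$ such that every permutation supported by both has a prefix-set in $\mathcal{G}$ and every permutation supported by $\mathcal{F}_1$ but not $\mathcal{F}_2$ has no prefix-set in $\mathcal{G}$; $\mathcal{F}$ is regularly self-intersecting if it is regularly intersecting with every set system isomorphic to it. For $1<S\le2$, $P'_S=\inf\{P(\mathcal{F}):\mathcal{F}\text{ regularly self-intersecting},\ S(\mathcal{F})\le S\}$. -}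

module Defs where

open import Data.Bool using (Bool; true; false; _∧_)
open import Data.Nat using (ℕ; zero; suc; _<ᵇ_; _+_; _*_; _^_; _≤_; _<_; _!)

open import Data.Fin using (Fin; toℕ)
open import Data.Fin.Subset using (Subset; _⊂_)
open import Data.Fin.Subset.Properties using (_⊂?_)
open import Data.Fin.Permutation using (Permutation′; _⟨$⟩ʳ_; _⟨$⟩ˡ_)
open import Data.Vec using (Vec; []; _∷_; tabulate; lookup)
open import Data.List using (List; []; _∷_; map; concatMap; length; filterᵇ; _++_)
open import Data.Product using (Σ; ∃; _×_; _,_)
open import Relation.Nullary using (¬_)
open import Relation.Nullary.Decidable using (⌊_⌋)
open import Relation.Binary.PropositionalEquality using (_≡_)

SetSystem : ℕ → Set
SetSystem n = Subset n → Bool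

allSubsets : (n : ℕ) → List (Subset n)
allSubsets zero = [] ∷ []
allSubsets (suc n) = map (false ∷_) (allSubsets n) ++ map (true ∷_) (allSubsets n)

allVecs : {A : Set} → List A → (m : ℕ) → List (Vec A m)
allVecs xs zero = [] ∷ []
allVecs xs (suc m) = concatMap (λ x → map (x ∷_) (allVecs xs m)) xs

card : {n : ℕ} → SetSystem n → ℕ
card {n} F = length (filterᵇ F (allSubsets n))

isChainIn : {n m : ℕ} → SetSystem n → Vec (Subset n) m → Bool
isChainIn F [] = true
isChainIn F (x ∷ []) = F x
isChainIn F (x ∷ y ∷ xs) = F x ∧ ⌊ x ⊂? y ⌋ ∧ isChainIn F (y ∷ xs)

chainCount : {n : ℕ} → SetSystem n → ℕ
chainCount {n} F = length (filterᵇ (isChainIn F) (allVecs (allSubsets n) (suc n)))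

-- prefix-set {π(1),...,π(i)} for i = 0..n  (with 0-based Fin: {π 0,...,π (i-1)})
prefixSet : {n : ℕ} → Permutation′ n → Fin (suc n) → Subset n
prefixSet π i = tabulate (λ j → toℕ (π ⟨$⟩ˡ j) <ᵇ toℕ i)

Supported : {n : ℕ} → SetSystem n → Permutation′ n → Set
Supported F π = ∀ i → F (prefixSet π i) ≡ true

-- the set system isomorphic to F via relabelling σ : [n] → [n]:
-- { σ[X] : X ∈ F };  Y ∈ relabel σ F  iff  σ⁻¹[Y] ∈ F
preimage : {n : ℕ} → Permutation′ n → Subset n → Subset n
preimage σ Y = tabulate (λ i → lookup Y (σ ⟨$⟩ʳ i))

relabel : {n : ℕ} → Permutation′ n → SetSystem n → SetSystem n
relabel σ F Y = F (preimage σ Y)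

RegularlyIntersecting : {n : ℕ} → SetSystem n → SetSystem n → Set
RegularlyIntersecting {n} F₁ F₂ =
  Σ (SetSystem n) λ G →
    (∀ X → G X ≡ true → (F₁ X ≡ true × F₂ X ≡ true))
    × (∀ π → Supported F₁ π → Supported F₂ π → ∃ λ i → G (prefixSet π i) ≡ true)
    × (∀ π → Supported F₁ π → ¬ Supported F₂ π → ∀ i → ¬ (G (prefixSet π i) ≡ true))

RegularlySelfIntersecting : {n : ℕ} → SetSystem n → Set
RegularlySelfIntersecting F = ∀ σ → RegularlyIntersecting F (relabel σ F)

-- S(F) ≤ a/b   ⇔  |F| * b^n ≤ a^n   (n ≥ 1)
SBoundedBy : {n : ℕ} → SetSystem n → ℕ → ℕ → Set
SBoundedBy {n} F a b = card F * b ^ n ≤ a ^ n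

-- P(F) < a/b   ⇔  C(F) > 0 and n!/C(F) < (a/b)^n  ⇔  n! * b^n < a^n * C(F)
-- (if C(F) = 0 then P(F) = +∞ and the right side is 0, so it fails, as it should)
PBelow : {n : ℕ} → SetSystem n → ℕ → ℕ → Set
PBelow {n} F a b = (n !) * b ^ n < a ^ n * chainCount F

{-# OPTIONS --safe #-}
module Submission where

-- Split the ground set [160 + 31] into A, its first 160 points, and B, its last 31, and let
-- F = {X : |X ∩ A| ≥ 119 or X ∩ B = ∅}. A member of F of size 119 lies inside A, so a permutation
-- with such a prefix set is supported by F: the earlier prefix sets avoid B and the later ones
-- contain 119 points of A. Hence G = F ∩ σF ∩ {|X| = 119} makes F and every relabelling σF
-- intersect regularly. Membership in F only depends on |X ∩ A| and |X ∩ B|, so |F| is a sum over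
-- size profiles weighted by rows of Pascal's triangle. Following chains one point at a time (points
-- of A until 119 of them are in, then anything) gives C(F) ≥ 160!/41! · 72!. Both numerical
-- inequalities are then decided by evaluation.

open import Defs
open import Data.Nat using (ℕ; _≤_)
open import Data.Product using (Σ; _×_)

open import Data.Bool using (Bool; true; false; not; if_then_else_; _∧_)
open import Data.Bool.Properties using (T-≡) renaming (_≟_ to _≟ᵇ_)
open import Data.Fin as Fin using (Fin; toℕ; fromℕ<)
open import Data.Fin.Properties using (toℕ<n; toℕ-fromℕ<)
open import Data.Fin.Permutation using (Permutation′; _⟨$⟩ʳ_; _⟨$⟩ˡ_; inverseˡ; _∘ₚ_; flip)
open import Data.Fin.Subset using (Subset; _⊆_; ∣_∣; ∁; ⊥)
open import Data.Fin.Subset.Properties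
  using (_⊂?_; p⊆q⇒∣p∣≤∣q∣; ∣⊥∣≡0; ∣∁p∣≡n∸∣p∣; drop-∷-⊆; out⊆; in⊆in; s⊂s; in⊂in; out⊂in; ⊆-refl)
open import Data.List using (List; []; _∷_; map; concatMap; length; filterᵇ; _++_)
open import Data.List.Properties using (map-++; map-∘; map-cong)
open import Data.Nat using (zero; suc; _+_; _*_; _∸_; _!; _^_; _<_; _<ᵇ_; _≤?_; _<?_; _≟_; z≤n; s≤s)
open import Data.Nat.ListAction using (sum)
open import Data.Nat.ListAction.Properties using (sum-++)
open import Data.Nat.Properties
open import Data.Nat.Solver using (module +-*-Solver)
open import Data.Product using (∃; _,_; proj₁; proj₂)
open import Data.Sum as Sum using (_⊎_; inj₁; inj₂)
open import Data.Vec using (Vec; []; _∷_; tabulate; lookup; take; drop; here)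
open import Data.Vec.Properties using (lookup∘tabulate; tabulate-cong; take-map; drop-map; []=⇒lookup; lookup⇒[]=)
open import Function using (_∘_; Equivalence)
open import Relation.Nullary using (¬_; Dec; yes; no; does; contradiction)
open import Relation.Nullary.Decidable using (⌊_⌋; _⊎-dec_; _×-dec_; dec-true; from-yes)
open import Relation.Binary.PropositionalEquality
  using (_≡_; refl; sym; trans; cong; cong₂; subst; module ≡-Reasoning)
import Algebra.Properties.CommutativeMonoid.Sum as CommutativeMonoidSum

module FinSum = CommutativeMonoidSum +-0-commutativeMonoid

dec-true⁻¹ : ∀ {P : Set} (P? : Dec P) → does P? ≡ true → P
dec-true⁻¹ (yes p) _ = p

boolToℕ : Bool → ℕ
boolToℕ false = 0
boolToℕ true  = 1

≤-if-⌊⌋ : ∀ {P : Set} (P? : Dec P) → P → ∀ v → v ≤ (if ⌊ P? ⌋ then v else 0)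
≤-if-⌊⌋ (yes _) _ v = ≤-refl
≤-if-⌊⌋ (no ¬p) p v = contradiction p ¬p

if-⌊⌋-mono : ∀ {P Q : Set} (P? : Dec P) (Q? : Dec Q) → (P → Q) → ∀ v →
             (if ⌊ P? ⌋ then v else 0) ≤ (if ⌊ Q? ⌋ then v else 0)
if-⌊⌋-mono (yes p) Q?  p⇒q v = ≤-if-⌊⌋ Q? (p⇒q p) v
if-⌊⌋-mono (no _)  _   _   v = z≤n

module _ {A : Set} where

  sum-map-++ : ∀ (g : A → ℕ) xs ys → sum (map g (xs ++ ys)) ≡ sum (map g xs) + sum (map g ys)
  sum-map-++ g xs ys = trans (cong sum (map-++ g xs ys)) (sum-++ (map g xs) (map g ys))

  sum-map-cong : ∀ {g h : A → ℕ} xs → (∀ x → g x ≡ h x) → sum (map g xs) ≡ sum (map h xs)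
  sum-map-cong xs g≗h = cong sum (map-cong g≗h xs)

  sum-map-mono : ∀ {g h : A → ℕ} xs → (∀ x → g x ≤ h x) → sum (map g xs) ≤ sum (map h xs)
  sum-map-mono []       _   = z≤n
  sum-map-mono (x ∷ xs) g≤h = +-mono-≤ (g≤h x) (sum-map-mono xs g≤h)

  sum-map-zero : ∀ xs → sum (map (λ (_ : A) → 0) xs) ≡ 0
  sum-map-zero []       = refl
  sum-map-zero (_ ∷ xs) = sum-map-zero xs

  length-filterᵇ : ∀ (p : A → Bool) xs → length (filterᵇ p xs) ≡ sum (map (boolToℕ ∘ p) xs)
  length-filterᵇ p [] = refl
  length-filterᵇ p (x ∷ xs) with p x
  ... | true  = cong suc (length-filterᵇ p xs)
  ... | false = length-filterᵇ p xs

  sum-map-boolToℕ-∧ : ∀ b (p : A → Bool) xs →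
    sum (map (λ x → boolToℕ (b ∧ p x)) xs) ≡ (if b then sum (map (boolToℕ ∘ p) xs) else 0)
  sum-map-boolToℕ-∧ true  p xs = refl
  sum-map-boolToℕ-∧ false p xs = sum-map-zero xs

sum-map-concatMap : ∀ {A B : Set} (g : B → ℕ) (f : A → List B) xs →
  sum (map g (concatMap f xs)) ≡ sum (map (λ x → sum (map g (f x))) xs)
sum-map-concatMap g f []       = refl
sum-map-concatMap g f (x ∷ xs) =
  trans (sum-map-++ g (f x) (concatMap f xs)) (cong (sum (map g (f x)) +_) (sum-map-concatMap g f xs))

sum-map-allVecs-suc : ∀ {A : Set} {m} (g : Vec A (suc m) → ℕ) xs →
  sum (map g (allVecs xs (suc m))) ≡ sum (map (λ x → sum (map (g ∘ (x ∷_)) (allVecs xs m))) xs)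
sum-map-allVecs-suc {m = m} g xs =
  trans (sum-map-concatMap g (λ x → map (x ∷_) (allVecs xs m)) xs)
        (sum-map-cong xs (λ x → cong sum (sym (map-∘ (allVecs xs m)))))

ΣSubsets : ∀ n → (Subset n → ℕ) → ℕ
ΣSubsets n f = sum (map f (allSubsets n))

ΣSubsets-suc : ∀ n (f : Subset (suc n) → ℕ) →
  ΣSubsets (suc n) f ≡ ΣSubsets n (f ∘ (false ∷_)) + ΣSubsets n (f ∘ (true ∷_))
ΣSubsets-suc n f =
  trans (sum-map-++ f (map (false ∷_) (allSubsets n)) (map (true ∷_) (allSubsets n)))
        (cong₂ _+_ (cong sum (sym (map-∘ (allSubsets n)))) (cong sum (sym (map-∘ (allSubsets n)))))

ΣSubsets-mono : ∀ n {f g : Subset n → ℕ} → (∀ x → f x ≤ g x) → ΣSubsets n f ≤ ΣSubsets n g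
ΣSubsets-mono n = sum-map-mono (allSubsets n)

term≤ΣSubsets : ∀ n (f : Subset n → ℕ) x → f x ≤ ΣSubsets n f
term≤ΣSubsets zero    f []          = m≤m+n (f []) 0
term≤ΣSubsets (suc n) f (false ∷ x) = begin
  f (false ∷ x)                                             ≤⟨ term≤ΣSubsets n (f ∘ (false ∷_)) x ⟩
  ΣSubsets n (f ∘ (false ∷_))                               ≤⟨ m≤m+n _ _ ⟩
  ΣSubsets n (f ∘ (false ∷_)) + ΣSubsets n (f ∘ (true ∷_))  ≡⟨ ΣSubsets-suc n f ⟨
  ΣSubsets (suc n) f                                        ∎
  where open ≤-Reasoning
term≤ΣSubsets (suc n) f (true ∷ x) = begin
  f (true ∷ x)                                              ≤⟨ term≤ΣSubsets n (f ∘ (true ∷_)) x ⟩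
  ΣSubsets n (f ∘ (true ∷_))                                ≤⟨ m≤n+m _ _ ⟩
  ΣSubsets n (f ∘ (false ∷_)) + ΣSubsets n (f ∘ (true ∷_))  ≡⟨ ΣSubsets-suc n f ⟨
  ΣSubsets (suc n) f                                        ∎
  where open ≤-Reasoning

card≡ΣSubsets : ∀ {n} (F : SetSystem n) → card F ≡ ΣSubsets n (boolToℕ ∘ F)
card≡ΣSubsets {n} F = length-filterᵇ F (allSubsets n)

weightedSum : List ℕ → (ℕ → ℕ) → ℕ
weightedSum []       f = 0
weightedSum (c ∷ cs) f = c * f 0 + weightedSum cs (f ∘ suc)

-- pascalStep p r adds r to r shifted by one place; p is the entry preceding r.
pascalStep : ℕ → List ℕ → List ℕ
pascalStep p []       = p ∷ []
pascalStep p (c ∷ cs) = (p + c) ∷ pascalStep c cs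

binomials : ℕ → List ℕ
binomials zero    = 1 ∷ []
binomials (suc m) = pascalStep 0 (binomials m)

weightedSum-pascalStep : ∀ p r (f : ℕ → ℕ) →
  weightedSum (pascalStep p r) f ≡ p * f 0 + weightedSum r (f ∘ suc) + weightedSum r f
weightedSum-pascalStep p []       f = cong (_+ 0) (sym (+-identityʳ (p * f 0)))
weightedSum-pascalStep p (c ∷ cs) f =
  trans (cong ((p + c) * f 0 +_) (weightedSum-pascalStep c cs (f ∘ suc)))
        (solve 6 (λ p c f₀ f₁ A B → (p :+ c) :* f₀ :+ (c :* f₁ :+ A :+ B)
                                    := p :* f₀ :+ (c :* f₁ :+ A) :+ (c :* f₀ :+ B))
               refl p c (f 0) (f 1) (weightedSum cs (f ∘ suc ∘ suc)) (weightedSum cs (f ∘ suc)))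
  where open +-*-Solver

weightedSum-binomials-zero : ∀ (f : ℕ → ℕ) → weightedSum (binomials 0) f ≡ f 0
weightedSum-binomials-zero f = trans (+-identityʳ (f 0 + 0)) (+-identityʳ (f 0))

weightedSum-binomials-suc : ∀ m (f : ℕ → ℕ) →
  weightedSum (binomials (suc m)) f ≡ weightedSum (binomials m) f + weightedSum (binomials m) (f ∘ suc)
weightedSum-binomials-suc m f =
  trans (weightedSum-pascalStep 0 (binomials m) f) (+-comm (weightedSum (binomials m) (f ∘ suc)) _)

ΣSubsets-by-size : ∀ m (f : ℕ → ℕ) → ΣSubsets m (f ∘ ∣_∣) ≡ weightedSum (binomials m) f
ΣSubsets-by-size zero    f = trans (+-identityʳ (f 0)) (sym (weightedSum-binomials-zero f))
ΣSubsets-by-size (suc m) f = begin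
  ΣSubsets (suc m) (f ∘ ∣_∣)                                          ≡⟨ ΣSubsets-suc m (f ∘ ∣_∣) ⟩
  ΣSubsets m (f ∘ ∣_∣) + ΣSubsets m (f ∘ suc ∘ ∣_∣)                   ≡⟨ cong₂ _+_ (ΣSubsets-by-size m f)
                                                                                   (ΣSubsets-by-size m (f ∘ suc)) ⟩
  weightedSum (binomials m) f + weightedSum (binomials m) (f ∘ suc)   ≡⟨ weightedSum-binomials-suc m f ⟨
  weightedSum (binomials (suc m)) f                                   ∎
  where open ≡-Reasoning

ΣSubsets-by-parts : ∀ a {b} (g : ℕ → ℕ → ℕ) →
  ΣSubsets (a + b) (λ X → g ∣ take a X ∣ ∣ drop a X ∣)
    ≡ weightedSum (binomials a) (λ i → weightedSum (binomials b) (g i))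
ΣSubsets-by-parts zero    {b} g =
  trans (ΣSubsets-by-size b (g 0)) (sym (weightedSum-binomials-zero (λ i → weightedSum (binomials b) (g i))))
ΣSubsets-by-parts (suc a) {b} g = begin
  ΣSubsets (suc a + b) (λ X → g ∣ take (suc a) X ∣ ∣ drop (suc a) X ∣)
    ≡⟨ ΣSubsets-suc (a + b) _ ⟩
  ΣSubsets (a + b) (λ X → g ∣ take a X ∣ ∣ drop a X ∣) + ΣSubsets (a + b) (λ X → g (suc ∣ take a X ∣) ∣ drop a X ∣)
    ≡⟨ cong₂ _+_ (ΣSubsets-by-parts a g) (ΣSubsets-by-parts a (g ∘ suc)) ⟩
  weightedSum (binomials a) h + weightedSum (binomials a) (h ∘ suc)
    ≡⟨ weightedSum-binomials-suc a h ⟨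
  weightedSum (binomials (suc a)) h
    ∎
  where
  open ≡-Reasoning
  h : ℕ → ℕ
  h i = weightedSum (binomials b) (g i)

chainsFrom : ∀ {n} → SetSystem n → ℕ → Subset n → ℕ
chainsFrom {n} F m x = sum (map (λ v → boolToℕ (isChainIn F (x ∷ v))) (allVecs (allSubsets n) m))

chainCount≡ΣchainsFrom : ∀ {n} (F : SetSystem n) → chainCount F ≡ ΣSubsets n (chainsFrom F n)
chainCount≡ΣchainsFrom {n} F =
  trans (length-filterᵇ (isChainIn F) (allVecs (allSubsets n) (suc n)))
        (sum-map-allVecs-suc (boolToℕ ∘ isChainIn F) (allSubsets n))

chainsFrom-zero : ∀ {n} (F : SetSystem n) x → chainsFrom F 0 x ≡ boolToℕ (F x)
chainsFrom-zero F x = +-identityʳ (boolToℕ (F x))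

ΣProperSupersets : ∀ {n} → Subset n → (Subset n → ℕ) → ℕ
ΣProperSupersets {n} x h = ΣSubsets n (λ y → if ⌊ x ⊂? y ⌋ then h y else 0)

chainsFrom-suc : ∀ {n} (F : SetSystem n) m x → F x ≡ true →
  chainsFrom F (suc m) x ≡ ΣProperSupersets x (chainsFrom F m)
chainsFrom-suc {n} F m x Fx =
  trans (sum-map-allVecs-suc (λ v → boolToℕ (isChainIn F (x ∷ v))) (allSubsets n))
        (sum-map-cong (allSubsets n) chainsThrough)
  where
  V : List (Vec (Subset n) m)
  V = allVecs (allSubsets n) m
  chainsThrough : ∀ y → sum (map (λ v → boolToℕ (F x ∧ (⌊ x ⊂? y ⌋ ∧ isChainIn F (y ∷ v)))) V)
                        ≡ (if ⌊ x ⊂? y ⌋ then chainsFrom F m y else 0)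
  chainsThrough y =
    trans (cong (λ b → sum (map (λ v → boolToℕ (b ∧ (⌊ x ⊂? y ⌋ ∧ isChainIn F (y ∷ v)))) V)) Fx)
          (sum-map-boolToℕ-∧ ⌊ x ⊂? y ⌋ (λ v → isChainIn F (y ∷ v)) V)

-- Σextensions x h is the sum of h (x ∪ ⁅ i ⁆) over all i ∉ x.
Σextensions : ∀ {n} → Subset n → (Subset n → ℕ) → ℕ
Σextensions []          h = 0
Σextensions (false ∷ x) h = h (true ∷ x) + Σextensions x (h ∘ (false ∷_))
Σextensions (true ∷ x)  h = Σextensions x (h ∘ (true ∷_))

Σextensions-mono : ∀ {n} (x : Subset n) {g h : Subset n → ℕ} →
  (∀ y → ∣ y ∣ ≡ suc ∣ x ∣ → g y ≤ h y) → Σextensions x g ≤ Σextensions x h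
Σextensions-mono []          _   = z≤n
Σextensions-mono (false ∷ x) g≤h = +-mono-≤ (g≤h (true ∷ x) refl) (Σextensions-mono x (λ y → g≤h (false ∷ y)))
Σextensions-mono (true ∷ x)  g≤h = Σextensions-mono x (λ y e → g≤h (true ∷ y) (cong suc e))

Σextensions≤ΣProperSupersets : ∀ {n} (x : Subset n) h → Σextensions x h ≤ ΣProperSupersets x h
Σextensions≤ΣProperSupersets []                  h = z≤n
Σextensions≤ΣProperSupersets {suc n} (false ∷ x) h = begin
  h (true ∷ x) + Σextensions x (h ∘ (false ∷_))
    ≤⟨ +-monoʳ-≤ (h (true ∷ x)) (Σextensions≤ΣProperSupersets x (h ∘ (false ∷_))) ⟩
  h (true ∷ x) + ΣProperSupersets x (h ∘ (false ∷_))
    ≤⟨ +-mono-≤ (≤-trans (≤-if-⌊⌋ (false ∷ x ⊂? true ∷ x) (out⊂in ⊆-refl) (h (true ∷ x)))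
                         (term≤ΣSubsets n (λ y → if ⌊ false ∷ x ⊂? true ∷ y ⌋ then h (true ∷ y) else 0) x))
                (ΣSubsets-mono n (λ y → if-⌊⌋-mono (x ⊂? y) (false ∷ x ⊂? false ∷ y) s⊂s (h (false ∷ y)))) ⟩
  ΣSubsets n (λ y → if ⌊ false ∷ x ⊂? true ∷ y ⌋ then h (true ∷ y) else 0)
    + ΣSubsets n (λ y → if ⌊ false ∷ x ⊂? false ∷ y ⌋ then h (false ∷ y) else 0)
    ≡⟨ +-comm (ΣSubsets n _) (ΣSubsets n _) ⟩
  ΣSubsets n (λ y → if ⌊ false ∷ x ⊂? false ∷ y ⌋ then h (false ∷ y) else 0)
    + ΣSubsets n (λ y → if ⌊ false ∷ x ⊂? true ∷ y ⌋ then h (true ∷ y) else 0)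
    ≡⟨ ΣSubsets-suc n _ ⟨
  ΣProperSupersets (false ∷ x) h
    ∎
  where open ≤-Reasoning
Σextensions≤ΣProperSupersets {suc n} (true ∷ x) h = begin
  Σextensions x (h ∘ (true ∷_))
    ≤⟨ Σextensions≤ΣProperSupersets x (h ∘ (true ∷_)) ⟩
  ΣProperSupersets x (h ∘ (true ∷_))
    ≤⟨ ΣSubsets-mono n (λ y → if-⌊⌋-mono (x ⊂? y) (true ∷ x ⊂? true ∷ y) in⊂in (h (true ∷ y))) ⟩
  ΣSubsets n (λ y → if ⌊ true ∷ x ⊂? true ∷ y ⌋ then h (true ∷ y) else 0)
    ≤⟨ m≤n+m _ _ ⟩
  ΣSubsets n (λ y → if ⌊ true ∷ x ⊂? false ∷ y ⌋ then h (false ∷ y) else 0)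
    + ΣSubsets n (λ y → if ⌊ true ∷ x ⊂? true ∷ y ⌋ then h (true ∷ y) else 0)
    ≡⟨ ΣSubsets-suc n _ ⟨
  ΣProperSupersets (true ∷ x) h
    ∎
  where open ≤-Reasoning

Σextensions≤chainsFrom-suc : ∀ {n} (F : SetSystem n) m x → F x ≡ true →
  Σextensions x (chainsFrom F m) ≤ chainsFrom F (suc m) x
Σextensions≤chainsFrom-suc F m x Fx =
  ≤-trans (Σextensions≤ΣProperSupersets x (chainsFrom F m)) (≤-reflexive (sym (chainsFrom-suc F m x Fx)))

Σextensions-by-size : ∀ {n} (x : Subset n) (g : ℕ → ℕ) → Σextensions x (g ∘ ∣_∣) ≡ ∣ ∁ x ∣ * g (suc ∣ x ∣)
Σextensions-by-size []          g = refl
Σextensions-by-size (false ∷ x) g = cong (g (suc ∣ x ∣) +_) (Σextensions-by-size x g)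
Σextensions-by-size (true ∷ x)  g = Σextensions-by-size x (g ∘ suc)

Σextensions-by-parts : ∀ a {b} (x : Subset (a + b)) (g : ℕ → ℕ → ℕ) →
  Σextensions x (λ y → g ∣ take a y ∣ ∣ drop a y ∣)
    ≡ ∣ ∁ (take a x) ∣ * g (suc ∣ take a x ∣) ∣ drop a x ∣ + ∣ ∁ (drop a x) ∣ * g ∣ take a x ∣ (suc ∣ drop a x ∣)
Σextensions-by-parts zero    x           g = Σextensions-by-size x (g 0)
Σextensions-by-parts (suc a) (false ∷ x) g =
  trans (cong (g (suc ∣ take a x ∣) ∣ drop a x ∣ +_) (Σextensions-by-parts a x g))
        (sym (+-assoc (g (suc ∣ take a x ∣) ∣ drop a x ∣) _ _))
Σextensions-by-parts (suc a) (true ∷ x)  g = Σextensions-by-parts a x (g ∘ suc)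

module _ {b : ℕ} where

  ∣take∣+∣drop∣ : ∀ a (x : Subset (a + b)) → ∣ take a x ∣ + ∣ drop a x ∣ ≡ ∣ x ∣
  ∣take∣+∣drop∣ zero    x           = refl
  ∣take∣+∣drop∣ (suc a) (false ∷ x) = ∣take∣+∣drop∣ a x
  ∣take∣+∣drop∣ (suc a) (true ∷ x)  = cong suc (∣take∣+∣drop∣ a x)

  ∣∁take∣+∣∁drop∣ : ∀ a (x : Subset (a + b)) → ∣ ∁ (take a x) ∣ + ∣ ∁ (drop a x) ∣ ≡ ∣ ∁ x ∣
  ∣∁take∣+∣∁drop∣ a x =
    trans (sym (cong₂ (λ p q → ∣ p ∣ + ∣ q ∣) (take-map not a x) (drop-map not a x))) (∣take∣+∣drop∣ a (∁ x))

  take-⊆ : ∀ a {x y : Subset (a + b)} → x ⊆ y → take a x ⊆ take a y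
  take-⊆ zero                              _   ()
  take-⊆ (suc a) {false ∷ x} {_ ∷ y}       x⊆y = out⊆ (take-⊆ a (drop-∷-⊆ x⊆y))
  take-⊆ (suc a) {true ∷ x}  {true ∷ y}    x⊆y = in⊆in (take-⊆ a (drop-∷-⊆ x⊆y))
  take-⊆ (suc a) {true ∷ x}  {false ∷ y}   x⊆y with () ← x⊆y here

  drop-⊆ : ∀ a {x y : Subset (a + b)} → x ⊆ y → drop a x ⊆ drop a y
  drop-⊆ zero                      x⊆y = x⊆y
  drop-⊆ (suc a) {_ ∷ x} {_ ∷ y}   x⊆y = drop-⊆ a (drop-∷-⊆ x⊆y)

  ∣take⊥∣ : ∀ a → ∣ take a (⊥ {a + b}) ∣ ≡ 0
  ∣take⊥∣ zero    = refl
  ∣take⊥∣ (suc a) = ∣take⊥∣ a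

  ∣drop⊥∣ : ∀ a → ∣ drop a (⊥ {a + b}) ∣ ≡ 0
  ∣drop⊥∣ zero    = ∣⊥∣≡0 b
  ∣drop⊥∣ (suc a) = ∣drop⊥∣ a

preimage-prefixSet : ∀ {n} (σ π : Permutation′ n) i → preimage σ (prefixSet π i) ≡ prefixSet (π ∘ₚ flip σ) i
preimage-prefixSet σ π i = tabulate-cong (λ t → lookup∘tabulate (λ j → toℕ (π ⟨$⟩ˡ j) <ᵇ toℕ i) (σ ⟨$⟩ʳ t))

prefixSet-mono : ∀ {n} (π : Permutation′ n) {i j : Fin (suc n)} → toℕ i ≤ toℕ j → prefixSet π i ⊆ prefixSet π j
prefixSet-mono π {i} {j} i≤j {t} t∈πi = lookup⇒[]= t _ (begin
  lookup (prefixSet π j) t   ≡⟨ lookup∘tabulate _ t ⟩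
  toℕ (π ⟨$⟩ˡ t) <ᵇ toℕ j    ≡⟨ Equivalence.to T-≡ (<⇒<ᵇ (<-≤-trans (<ᵇ⇒< _ _ (Equivalence.from T-≡ t<i)) i≤j)) ⟩
  true                       ∎)
  where
  open ≡-Reasoning
  t<i : (toℕ (π ⟨$⟩ˡ t) <ᵇ toℕ i) ≡ true
  t<i = trans (sym (lookup∘tabulate _ t)) ([]=⇒lookup t∈πi)

∣tabulate∣ : ∀ {n} (g : Fin n → Bool) → ∣ tabulate g ∣ ≡ FinSum.sum (boolToℕ ∘ g)
∣tabulate∣ {zero}  g = refl
∣tabulate∣ {suc n} g with g Fin.zero
... | true  = cong suc (∣tabulate∣ (g ∘ Fin.suc))
... | false = ∣tabulate∣ (g ∘ Fin.suc)

count-<ᵇ : ∀ n t → t ≤ n → FinSum.sum {n} (λ j → boolToℕ (toℕ j <ᵇ t)) ≡ t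
count-<ᵇ zero    zero    _         = refl
count-<ᵇ (suc n) zero    _         = FinSum.sum-replicate-zero n
count-<ᵇ (suc n) (suc t) (s≤s t≤n) = cong suc (count-<ᵇ n t t≤n)

∣prefixSet∣ : ∀ {n} (π : Permutation′ n) i → ∣ prefixSet π i ∣ ≡ toℕ i
∣prefixSet∣ {n} π i = begin
  ∣ prefixSet π i ∣                                          ≡⟨ ∣tabulate∣ (λ j → toℕ (π ⟨$⟩ˡ j) <ᵇ toℕ i) ⟩
  FinSum.sum (λ j → below (π ⟨$⟩ˡ j))                        ≡⟨ FinSum.sum-permute (below ∘ (π ⟨$⟩ˡ_)) π ⟩
  FinSum.sum (λ j → below (π ⟨$⟩ˡ (π ⟨$⟩ʳ j)))               ≡⟨ FinSum.sum-cong-≗ (λ j → cong below (inverseˡ π {j})) ⟩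
  FinSum.sum below                                           ≡⟨ count-<ᵇ n (toℕ i) (≤-pred (toℕ<n i)) ⟩
  toℕ i                                                      ∎
  where
  open ≡-Reasoning
  below : Fin n → ℕ
  below j = boolToℕ (toℕ j <ᵇ toℕ i)

module ThresholdSystem (a b k : ℕ) where

  ∣_∩A∣ ∣_∩B∣ : Subset (a + b) → ℕ
  ∣ X ∩A∣ = ∣ take a X ∣
  ∣ X ∩B∣ = ∣ drop a X ∣

  Admissible : ℕ → ℕ → Set
  Admissible α β = k ≤ α ⊎ β ≡ 0

  admissible? : ∀ α β → Dec (Admissible α β)
  admissible? α β = k ≤? α ⊎-dec β ≟ 0

  F : SetSystem (a + b)
  F X = does (admissible? ∣ X ∩A∣ ∣ X ∩B∣)

  cardFormula : ℕ
  cardFormula = weightedSum (binomials a) (λ i → weightedSum (binomials b) (λ j → boolToℕ (does (admissible? i j))))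

  card≡cardFormula : card F ≡ cardFormula
  card≡cardFormula = trans (card≡ΣSubsets F) (ΣSubsets-by-parts a (λ i j → boolToℕ (does (admissible? i j))))

  size-k-member⇒⊆A : ∀ X → F X ≡ true → ∣ X ∣ ≡ k → k ≤ ∣ X ∩A∣ × ∣ X ∩B∣ ≡ 0
  size-k-member⇒⊆A X FX ∣X∣≡k = split (dec-true⁻¹ (admissible? ∣ X ∩A∣ ∣ X ∩B∣) FX)
    where
    open ≤-Reasoning
    α+β≡k : ∣ X ∩A∣ + ∣ X ∩B∣ ≡ k
    α+β≡k = trans (∣take∣+∣drop∣ a X) ∣X∣≡k
    split : Admissible ∣ X ∩A∣ ∣ X ∩B∣ → k ≤ ∣ X ∩A∣ × ∣ X ∩B∣ ≡ 0
    split (inj₁ k≤α) = k≤α , n≤0⇒n≡0 (+-cancelˡ-≤ ∣ X ∩A∣ ∣ X ∩B∣ 0 (begin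
      ∣ X ∩A∣ + ∣ X ∩B∣  ≡⟨ α+β≡k ⟩
      k                  ≤⟨ k≤α ⟩
      ∣ X ∩A∣            ≡⟨ +-identityʳ ∣ X ∩A∣ ⟨
      ∣ X ∩A∣ + 0        ∎))
    split (inj₂ β≡0) = (begin
      k                  ≡⟨ α+β≡k ⟨
      ∣ X ∩A∣ + ∣ X ∩B∣  ≡⟨ cong (∣ X ∩A∣ +_) β≡0 ⟩
      ∣ X ∩A∣ + 0        ≡⟨ +-identityʳ ∣ X ∩A∣ ⟩
      ∣ X ∩A∣            ∎) , β≡0

  ∣∩A∣-mono : ∀ {X Y} → X ⊆ Y → ∣ X ∩A∣ ≤ ∣ Y ∩A∣
  ∣∩A∣-mono X⊆Y = p⊆q⇒∣p∣≤∣q∣ (take-⊆ a X⊆Y)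

  ∣∩B∣-mono : ∀ {X Y} → X ⊆ Y → ∣ X ∩B∣ ≤ ∣ Y ∩B∣
  ∣∩B∣-mono X⊆Y = p⊆q⇒∣p∣≤∣q∣ (drop-⊆ a X⊆Y)

  prefix-of-size-k⇒Supported : ∀ (ρ : Permutation′ (a + b)) i →
    F (prefixSet ρ i) ≡ true → toℕ i ≡ k → Supported F ρ
  prefix-of-size-k⇒Supported ρ i Fρi i≡k j =
    dec-true (admissible? ∣ Y ∩A∣ ∣ Y ∩B∣) (Sum.map later earlier (≤-total (toℕ i) (toℕ j)))
    where
    Y : Subset (a + b)
    Y = prefixSet ρ j
    inside-A : k ≤ ∣ prefixSet ρ i ∩A∣ × ∣ prefixSet ρ i ∩B∣ ≡ 0
    inside-A = size-k-member⇒⊆A (prefixSet ρ i) Fρi (trans (∣prefixSet∣ ρ i) i≡k)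
    later : toℕ i ≤ toℕ j → k ≤ ∣ Y ∩A∣
    later i≤j = ≤-trans (proj₁ inside-A) (∣∩A∣-mono (prefixSet-mono ρ i≤j))
    earlier : toℕ j ≤ toℕ i → ∣ Y ∩B∣ ≡ 0
    earlier j≤i = n≤0⇒n≡0 (≤-trans (∣∩B∣-mono (prefixSet-mono ρ j≤i)) (≤-reflexive (proj₂ inside-A)))

  regularlySelfIntersecting : k ≤ a + b → RegularlySelfIntersecting F
  regularlySelfIntersecting k≤n σ = G , G⊆F∩σF , hit , miss
    where
    σF : SetSystem (a + b)
    σF = relabel σ F
    G? : ∀ X → Dec (F X ≡ true × σF X ≡ true × ∣ X ∣ ≡ k)
    G? X = (F X ≟ᵇ true) ×-dec (σF X ≟ᵇ true) ×-dec (∣ X ∣ ≟ k)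
    G : SetSystem (a + b)
    G X = does (G? X)
    G⊆F∩σF : ∀ X → G X ≡ true → F X ≡ true × σF X ≡ true
    G⊆F∩σF X GX with FX , σFX , _ ← dec-true⁻¹ (G? X) GX
      = FX , σFX
    iₖ : Fin (suc (a + b))
    iₖ = fromℕ< (s≤s k≤n)
    hit : ∀ π → Supported F π → Supported σF π → ∃ λ i → G (prefixSet π i) ≡ true
    hit π Fπ σFπ = iₖ , dec-true (G? (prefixSet π iₖ))
                                 (Fπ iₖ , σFπ iₖ , trans (∣prefixSet∣ π iₖ) (toℕ-fromℕ< (s≤s k≤n)))
    miss : ∀ π → Supported F π → ¬ Supported σF π → ∀ i → ¬ (G (prefixSet π i) ≡ true)
    miss π _ ¬σFπ i Gπi = ¬σFπ λ j → trans (cong F (preimage-prefixSet σ π j)) (ρ-supported j)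
      where
      X : Subset (a + b)
      X = prefixSet π i
      ρ : Permutation′ (a + b)
      ρ = π ∘ₚ flip σ
      ρ-supported : Supported F ρ
      ρ-supported with _ , σFX , ∣X∣≡k ← dec-true⁻¹ (G? X) Gπi
        = prefix-of-size-k⇒Supported ρ i (trans (cong F (sym (preimage-prefixSet σ π i))) σFX)
                                         (trans (sym (∣prefixSet∣ π i)) ∣X∣≡k)

  -- chainBound m α β counts the chains that start at a set with α points in A and β in B and still
  -- have m points to add: once k points of A are in, the rest may come in any order; before that
  -- only points of A may be added.
  chainBound : ℕ → ℕ → ℕ → ℕ
  chainBound m α β with k ≤? α
  chainBound m       α β       | yes _ = m !
  chainBound zero    α β       | no _  = 0
  chainBound (suc m) α zero    | no _  = (a ∸ α) * chainBound m (suc α) zero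
  chainBound (suc m) α (suc β) | no _  = 0

  chainBound-free : ∀ m {α} β → k ≤ α → chainBound m α β ≡ m !
  chainBound-free m {α} β k≤α with k ≤? α
  ... | yes _    = refl
  ... | no k≰α   = contradiction k≤α k≰α

  chainBound-zero : ∀ α β → chainBound 0 α β ≤ boolToℕ (does (admissible? α β))
  chainBound-zero α β with k ≤? α
  ... | yes k≤α = ≤-reflexive (cong boolToℕ (sym (dec-true (admissible? α β) (inj₁ k≤α))))
  ... | no _    = z≤n

  chainBound-inadmissible : ∀ m α β → ¬ Admissible α β → chainBound (suc m) α β ≡ 0
  chainBound-inadmissible m α β ¬adm with k ≤? α
  chainBound-inadmissible m α β       ¬adm | yes k≤α = contradiction (inj₁ k≤α) ¬adm
  chainBound-inadmissible m α zero    ¬adm | no _    = contradiction (inj₂ refl) ¬adm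
  chainBound-inadmissible m α (suc β) ¬adm | no _    = refl

  chainBound-low : ∀ m {α} → α < k → chainBound (suc m) α 0 ≡ (a ∸ α) * chainBound m (suc α) 0
  chainBound-low m {α} α<k with k ≤? α
  ... | yes k≤α = contradiction k≤α (<⇒≱ α<k)
  ... | no _    = refl

  chainBound-suc : ∀ m α β {fa fb} → Admissible α β → fa ≡ a ∸ α → fa + fb ≡ suc m →
    chainBound (suc m) α β ≤ fa * chainBound m (suc α) β + fb * chainBound m α (suc β)
  chainBound-suc m α β {fa} {fb} adm fa≡ fa+fb≡ with ≤-<-connex k α | adm
  ... | inj₁ k≤α | _ = ≤-reflexive (begin
    chainBound (suc m) α β                                        ≡⟨ chainBound-free (suc m) β k≤α ⟩
    suc m * m !                                                   ≡⟨ cong (_* m !) fa+fb≡ ⟨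
    (fa + fb) * m !                                               ≡⟨ *-distribʳ-+ (m !) fa fb ⟩
    fa * m ! + fb * m !                                           ≡⟨ cong₂ (λ p q → fa * p + fb * q)
                                                                           (chainBound-free m β (m≤n⇒m≤1+n k≤α))
                                                                           (chainBound-free m (suc β) k≤α) ⟨
    fa * chainBound m (suc α) β + fb * chainBound m α (suc β)     ∎)
    where open ≡-Reasoning
  ... | inj₂ α<k | inj₁ k≤α = contradiction k≤α (<⇒≱ α<k)
  ... | inj₂ α<k | inj₂ refl = begin
    chainBound (suc m) α 0                                        ≡⟨ chainBound-low m α<k ⟩
    (a ∸ α) * chainBound m (suc α) 0                              ≡⟨ cong (_* chainBound m (suc α) 0) fa≡ ⟨
    fa * chainBound m (suc α) 0                                   ≤⟨ m≤m+n _ _ ⟩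
    fa * chainBound m (suc α) 0 + fb * chainBound m α 1           ∎
    where open ≤-Reasoning

  chainBound≤chainsFrom : ∀ m X → ∣ X ∣ + m ≡ a + b → chainBound m ∣ X ∩A∣ ∣ X ∩B∣ ≤ chainsFrom F m X
  chainBound≤chainsFrom zero X _ =
    ≤-trans (chainBound-zero ∣ X ∩A∣ ∣ X ∩B∣) (≤-reflexive (sym (chainsFrom-zero F X)))
  chainBound≤chainsFrom (suc m) X ∣X∣+m+1≡n with admissible? ∣ X ∩A∣ ∣ X ∩B∣ in FX
  ... | no ¬adm = ≤-trans (≤-reflexive (chainBound-inadmissible m ∣ X ∩A∣ ∣ X ∩B∣ ¬adm)) z≤n
  ... | yes adm = begin
    chainBound (suc m) ∣ X ∩A∣ ∣ X ∩B∣
      ≤⟨ chainBound-suc m ∣ X ∩A∣ ∣ X ∩B∣ adm (∣∁p∣≡n∸∣p∣ (take a X)) ∣∁X∣≡m+1 ⟩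
    ∣ ∁ (take a X) ∣ * chainBound m (suc ∣ X ∩A∣) ∣ X ∩B∣ + ∣ ∁ (drop a X) ∣ * chainBound m ∣ X ∩A∣ (suc ∣ X ∩B∣)
      ≡⟨ Σextensions-by-parts a X (chainBound m) ⟨
    Σextensions X (λ Y → chainBound m ∣ Y ∩A∣ ∣ Y ∩B∣)
      ≤⟨ Σextensions-mono X (λ Y ∣Y∣≡ → chainBound≤chainsFrom m Y (size-below Y ∣Y∣≡)) ⟩
    Σextensions X (chainsFrom F m)
      ≤⟨ Σextensions≤chainsFrom-suc F m X (cong does FX) ⟩
    chainsFrom F (suc m) X
      ∎
    where
    open ≤-Reasoning
    ∣∁X∣≡m+1 : ∣ ∁ (take a X) ∣ + ∣ ∁ (drop a X) ∣ ≡ suc m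
    ∣∁X∣≡m+1 = trans (∣∁take∣+∣∁drop∣ a X)
               (trans (∣∁p∣≡n∸∣p∣ X) (trans (cong (_∸ ∣ X ∣) (sym ∣X∣+m+1≡n)) (m+n∸m≡n ∣ X ∣ (suc m))))
    size-below : ∀ Y → ∣ Y ∣ ≡ suc ∣ X ∣ → ∣ Y ∣ + m ≡ a + b
    size-below Y ∣Y∣≡ = trans (cong (_+ m) ∣Y∣≡) (trans (sym (+-suc ∣ X ∣ m)) ∣X∣+m+1≡n)

  chainBound≤chainCount : chainBound (a + b) 0 0 ≤ chainCount F
  chainBound≤chainCount = begin
    chainBound (a + b) 0 0                     ≡⟨ cong₂ (chainBound (a + b)) (∣take⊥∣ a) (∣drop⊥∣ a) ⟨
    chainBound (a + b) ∣ ⊥ ∩A∣ ∣ ⊥ ∩B∣         ≤⟨ chainBound≤chainsFrom (a + b) ⊥ (cong (_+ (a + b)) (∣⊥∣≡0 (a + b))) ⟩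
    chainsFrom F (a + b) ⊥                     ≤⟨ term≤ΣSubsets (a + b) (chainsFrom F (a + b)) ⊥ ⟩
    ΣSubsets (a + b) (chainsFrom F (a + b))    ≡⟨ chainCount≡ΣchainsFrom F ⟨
    chainCount F                               ∎
    where open ≤-Reasoning

  SBoundedBy-F : ∀ s t → cardFormula * t ^ (a + b) ≤ s ^ (a + b) → SBoundedBy F s t
  SBoundedBy-F s t = subst (λ c → c * t ^ (a + b) ≤ s ^ (a + b)) (sym card≡cardFormula)

  PBelow-F : ∀ s t → (a + b) ! * t ^ (a + b) < s ^ (a + b) * chainBound (a + b) 0 0 → PBelow F s t
  PBelow-F s t below = <-≤-trans below (*-monoʳ-≤ (s ^ (a + b)) chainBound≤chainCount)

corollary4p6 : Σ ℕ λ n → Σ (SetSystem n) λ F →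
    1 ≤ n × RegularlySelfIntersecting F × SBoundedBy F 17916 10000 × PBelow F 120375 100000
-- The ground set is written 160 + 31 rather than 191 so that all types agree syntactically; otherwise
-- the conversion checker unfolds card F and chainCount F, which range over 2^191 subsets.
corollary4p6 =
  160 + 31 , F , s≤s z≤n ,
  regularlySelfIntersecting (from-yes (119 ≤? 160 + 31)) ,
  SBoundedBy-F 17916 10000 (from-yes (cardFormula * 10000 ^ (160 + 31) ≤? 17916 ^ (160 + 31))) ,
  PBelow-F 120375 100000 (from-yes ((160 + 31) ! * 100000 ^ (160 + 31) <? 120375 ^ (160 + 31) * chainBound (160 + 31) 0 0))
  where open ThresholdSystem 160 31 119
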